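{- (De-focalization.) Let $\Gamma$ be a hypothetical context, $L$ an antecedent and $U$ a succedent of the focused calculus, with $\Gamma$ and $U$ suspension-normal (so that the erasures below are defined). If the focused sequent $\Gamma; L \vdash U$ is derivable, then the unfocused sequent with ordered part $(\Gamma)^\circledast; (L)^\circledast \vdash (U)^\circledast$ is derivable. Equivalently: (1) if $\Gamma \vdash [A^+]$ then $(\Gamma)^\circledast; \cdot \vdash (A^+)^\bullet$; (2) if $\Gamma; \Omega \vdash U$ then $(\Gamma)^\circledast; (\Omega)^\bullet \vdash (U)^\circledast$; (3) if $\Gamma; [A^-] \vdash U$ then $(\Gamma)^\circledast; (A^-)^\bullet \vdash (U)^\circledast$.
   Context: Unfocused logic. Unpolarized propositions: $P,Q ::= p \mid \bot \mid P_1\vee P_2 \mid \top \mid P_1 \wedge P_2 \mid P_1 \supset P_2$. Unfocused sequents $\Gamma \vdash P$ with $\Gamma$ a multiset of propositions, derived by the rules: init: $\Gamma,p \vdash p$; $\bot_L$: $\Gamma,\bot\vdash Q$; $\vee_{Ri}$: from $\Gamma\vdash P_i$ infer $\Gamma\vdash P_1\vee P_2$ ($i=1,2$); $\vee_L$: from $\Gamma,P_1\vee P_2,P_1\vdash Q$ and $\Gamma,P_1\vee P_2,P_2\vdash Q$ infer $\Gamma,P_1\vee P_2\vdash Q$; $\top_R$: $\Gamma\vdash\top$; $\wedge_R$: from $\Gamma\vdash P_1$ and $\Gamma\vdash P_2$ infer $\Gamma\vdash P_1\wedge P_2$; $\wedge_{Li}$: from $\Gamma,P_1\wedge P_2,P_i\vdash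 Q$ infer $\Gamma,P_1\wedge P_2\vdash Q$; $\supset_R$: from $\Gamma,P_1\vdash P_2$ infer $\Gamma\vdash P_1\supset P_2$; $\supset_L$: from $\Gamma,P_1\supset P_2\vdash P_1$ and $\Gamma,P_1\supset P_2,P_2\vdash Q$ infer $\Gamma,P_1\supset P_2\vdash Q$. (No $\bot_R$, no $\top_L$.) For an ordered sequence $\Psi$ of propositions, the sequent $\Gamma;\Psi\vdash Q$ is defined by exactly two rules: cons: from $\Gamma,P;\Psi\vdash Q$ infer $\Gamma;P,\Psi\vdash Q$; nil: from $\Gamma\vdash Q$ infer $\Gamma;\cdot\vdash Q$. Polarized propositions (each atom has a fixed polarity): $A^+ ::= p^+ \mid {\downarrow}A^- \mid \bot \mid A^+\vee B^+ \mid \top^+ \mid A^+\wedge^+ B^+$; $A^- ::= p^- \mid {\uparrow}A^+ \mid A^+\supset B^- \mid \top^- \mid A^-\wedge^- B^-$. Hypothetical contexts (multisets): $\Gamma ::= \cdot \mid \Gamma,A^- \mid \Gamma,\langle A^+\rangle$ (the latter a suspended positive proposition). Inversion contexts $\Omega$: ordered sequences of positive propositions. Antecedents $L ::= \Omega \mid [A^-]$. Succedents $U ::= [A^+] \mid A^+ \mid A^- \mid \langle A^-\rangle$. $U$ is stable iff it is of the form $A^+$ (unbracketed) or $\langle A^-\rangle$. Sequents $\Gamma;L\vdash U$ come in three forms: right focus $\Gamma\vdash[A^+]$ (i.e. $L=\cdot$, $U=[A^+]$); inversion $\Gamma;\Omega\vdash U$ with $U$ not of the form $[A^+]$; left focus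 $\Gamma;[A^-]\vdash U$ with $U$ stable. Rules. Right focus: $id^+$: $\Gamma,\langle A^+\rangle\vdash[A^+]$; ${\downarrow}_R$: from $\Gamma;\cdot\vdash A^-$ infer $\Gamma\vdash[{\downarrow}A^-]$; $\vee_{R1}$/$\vee_{R2}$: from $\Gamma\vdash[A^+]$ (resp. $[B^+]$) infer $\Gamma\vdash[A^+\vee B^+]$; $\top^+_R$: $\Gamma\vdash[\top^+]$; $\wedge^+_R$: from $\Gamma\vdash[A^+]$, $\Gamma\vdash[B^+]$ infer $\Gamma\vdash[A^+\wedge^+B^+]$. Inversion: $foc_R$: from $\Gamma\vdash[A^+]$ infer $\Gamma;\cdot\vdash A^+$; $foc_L$: from $\Gamma,A^-;[A^-]\vdash U$ with $U$ stable infer $\Gamma,A^-;\cdot\vdash U$; $\eta^+$: from $\Gamma,\langle p^+\rangle;\Omega\vdash U$ infer $\Gamma;p^+,\Omega\vdash U$; ${\downarrow}_L$: from $\Gamma,A^-;\Omega\vdash U$ infer $\Gamma;{\downarrow}A^-,\Omega\vdash U$; $\bot_L$: $\Gamma;\bot,\Omega\vdash U$; $\vee_L$: from $\Gamma;A^+,\Omega\vdash U$ and $\Gamma;B^+,\Omega\vdash U$ infer $\Gamma;A^+\vee B^+,\Omega\vdash U$; $\top^+_L$: from $\Gamma;\Omega\vdash U$ infer $\Gamma;\top^+,\Omega\vdash U$; $\wedge^+_L$: from $\Gamma;A^+,B^+,\Omega\vdash U$ infer $\Gamma;A^+\wedge^+B^+,\Omega\vdash U$; $\eta^-$: from $\Gamma;\cdot\vdash\langle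 p^-\rangle$ infer $\Gamma;\cdot\vdash p^-$; ${\uparrow}_R$: from $\Gamma;\cdot\vdash A^+$ infer $\Gamma;\cdot\vdash{\uparrow}A^+$; $\supset_R$: from $\Gamma;A^+\vdash B^-$ infer $\Gamma;\cdot\vdash A^+\supset B^-$; $\top^-_R$: $\Gamma;\cdot\vdash\top^-$; $\wedge^-_R$: from $\Gamma;\cdot\vdash A^-$ and $\Gamma;\cdot\vdash B^-$ infer $\Gamma;\cdot\vdash A^-\wedge^-B^-$. Left focus ($U$ stable): $id^-$: $\Gamma;[A^-]\vdash\langle A^-\rangle$; ${\uparrow}_L$: from $\Gamma;A^+\vdash U$ infer $\Gamma;[{\uparrow}A^+]\vdash U$; $\supset_L$: from $\Gamma\vdash[A^+]$ and $\Gamma;[B^-]\vdash U$ infer $\Gamma;[A^+\supset B^-]\vdash U$; $\wedge^-_{L1}$/$\wedge^-_{L2}$: from $\Gamma;[A^-]\vdash U$ (resp. $[B^-]$) infer $\Gamma;[A^-\wedge^-B^-]\vdash U$. (No $\bot_R$, no $\top^-_L$.) A context or succedent is suspension-normal if every suspended proposition $\langle A^+\rangle$ or $\langle A^-\rangle$ in it is atomic. Erasure: $(p^\pm)^\bullet=p$, $({\downarrow}A^-)^\bullet=(A^-)^\bullet$, $({\uparrow}A^+)^\bullet=(A^+)^\bullet$, $\bot^\bullet=\bot$, $(\top^\pm)^\bullet=\top$, $(A\vee B)^\bullet=A^\bullet\vee B^\bullet$, $(A\wedge^\pm B)^\bullet=A^\bullet\wedge B^\bullet$, $(A^+\supset B^-)^\bullet=(A^+)^\bullet\supset(B^-)^\bullet$;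 $(\Omega)^\bullet$ erases pointwise. On suspension-normal contexts/succedents only: $(\cdot)^\circledast=\cdot$, $(\Gamma,A^-)^\circledast=(\Gamma)^\circledast,(A^-)^\bullet$, $(\Gamma,\langle p^+\rangle)^\circledast=(\Gamma)^\circledast,p^+$; $([A^-])^\circledast=(A^-)^\bullet$, $(\Omega)^\circledast=(\Omega)^\bullet$; $([A^+])^\circledast=(A^+)^\circledast=(A^+)^\bullet$, $(A^-)^\circledast=(A^-)^\bullet$, $(\langle p^-\rangle)^\circledast=p^-$. -}

module Defs where

open import Data.List using (List; []; _∷_)
open import Data.List.Membership.Propositional using (_∈_)
open import Data.List.Relation.Unary.All using (All; []; _∷_)
open import Relation.Binary.PropositionalEquality using (_≡_)

data Polarity : Set where
  positive negative : Polarity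

module Logic (Atom : Set) (pol : Atom → Polarity) where

  data Prop : Set where
    atom : Atom → Prop
    ⊥ᵘ   : Prop
    _∨ᵘ_ : Prop → Prop → Prop
    ⊤ᵘ   : Prop
    _∧ᵘ_ : Prop → Prop → Prop
    _⊃ᵘ_ : Prop → Prop → Prop

  -- Multiset contexts are represented by lists; every rule only ever
  -- extends the context or inspects membership, so derivability is
  -- invariant under permutation, matching the multiset reading.
  UCtx : Set
  UCtx = List Prop

  infix 4 _⊢ᵘ_
  data _⊢ᵘ_ : UCtx → Prop → Set where
    init  : ∀ {Γ p} → atom p ∈ Γ → Γ ⊢ᵘ atom p
    ⊥L    : ∀ {Γ Q} → ⊥ᵘ ∈ Γ → Γ ⊢ᵘ Q
    ∨R1   : ∀ {Γ P₁ P₂} → Γ ⊢ᵘ P₁ → Γ ⊢ᵘ P₁ ∨ᵘ P₂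
    ∨R2   : ∀ {Γ P₁ P₂} → Γ ⊢ᵘ P₂ → Γ ⊢ᵘ P₁ ∨ᵘ P₂
    ∨L    : ∀ {Γ P₁ P₂ Q} → (P₁ ∨ᵘ P₂) ∈ Γ →
            (P₁ ∷ Γ) ⊢ᵘ Q → (P₂ ∷ Γ) ⊢ᵘ Q → Γ ⊢ᵘ Q
    ⊤R    : ∀ {Γ} → Γ ⊢ᵘ ⊤ᵘ
    ∧R    : ∀ {Γ P₁ P₂} → Γ ⊢ᵘ P₁ → Γ ⊢ᵘ P₂ → Γ ⊢ᵘ P₁ ∧ᵘ P₂
    ∧L1   : ∀ {Γ P₁ P₂ Q} → (P₁ ∧ᵘ P₂) ∈ Γ → (P₁ ∷ Γ) ⊢ᵘ Q → Γ ⊢ᵘ Q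
    ∧L2   : ∀ {Γ P₁ P₂ Q} → (P₁ ∧ᵘ P₂) ∈ Γ → (P₂ ∷ Γ) ⊢ᵘ Q → Γ ⊢ᵘ Q
    ⊃R    : ∀ {Γ P₁ P₂} → (P₁ ∷ Γ) ⊢ᵘ P₂ → Γ ⊢ᵘ P₁ ⊃ᵘ P₂
    ⊃L    : ∀ {Γ P₁ P₂ Q} → (P₁ ⊃ᵘ P₂) ∈ Γ →
            Γ ⊢ᵘ P₁ → (P₂ ∷ Γ) ⊢ᵘ Q → Γ ⊢ᵘ Q

  infix 4 _⨾_⊢ᵘ_
  data _⨾_⊢ᵘ_ : UCtx → List Prop → Prop → Set where
    nil  : ∀ {Γ Q} → Γ ⊢ᵘ Q → Γ ⨾ [] ⊢ᵘ Q
    cons : ∀ {Γ P Ψ Q} → (P ∷ Γ) ⨾ Ψ ⊢ᵘ Q → Γ ⨾ (P ∷ Ψ) ⊢ᵘ Q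

  mutual
    data Pos : Set where
      patom : (a : Atom) → pol a ≡ positive → Pos
      ↓_    : Neg → Pos
      ⊥⁺    : Pos
      _∨⁺_  : Pos → Pos → Pos
      ⊤⁺    : Pos
      _∧⁺_  : Pos → Pos → Pos

    data Neg : Set where
      natom : (a : Atom) → pol a ≡ negative → Neg
      ↑_    : Pos → Neg
      _⊃⁻_  : Pos → Neg → Neg
      ⊤⁻    : Neg
      _∧⁻_  : Neg → Neg → Neg

  data Hyp : Set where
    hneg  : Neg → Hyp
    hsusp : Pos → Hyp

  Ctx : Set
  Ctx = List Hyp

  ICtx : Set
  ICtx = List Pos

  -- Succedents allowed in inversion sequents: A⁺, A⁻, ⟨A⁻⟩
  -- (i.e. every succedent except [A⁺]).
  data ISucc : Set where
    spos  : Pos → ISucc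
    sneg  : Neg → ISucc
    ssusp : Neg → ISucc

  data Stable : Set where
    stpos  : Pos → Stable
    stsusp : Neg → Stable

  stable→isucc : Stable → ISucc
  stable→isucc (stpos A)  = spos A
  stable→isucc (stsusp A) = ssusp A

  mutual
    infix 4 _⊢[_]
    data _⊢[_] : Ctx → Pos → Set where
      id⁺  : ∀ {Γ A} → hsusp A ∈ Γ → Γ ⊢[ A ]
      ↓R   : ∀ {Γ A} → Γ ⨾ [] ⊢ sneg A → Γ ⊢[ ↓ A ]
      ∨R1  : ∀ {Γ A B} → Γ ⊢[ A ] → Γ ⊢[ A ∨⁺ B ]
      ∨R2  : ∀ {Γ A B} → Γ ⊢[ B ] → Γ ⊢[ A ∨⁺ B ]
      ⊤⁺R  : ∀ {Γ} → Γ ⊢[ ⊤⁺ ]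
      ∧⁺R  : ∀ {Γ A B} → Γ ⊢[ A ] → Γ ⊢[ B ] → Γ ⊢[ A ∧⁺ B ]

    infix 4 _⨾_⊢_
    data _⨾_⊢_ : Ctx → ICtx → ISucc → Set where
      focR : ∀ {Γ A} → Γ ⊢[ A ] → Γ ⨾ [] ⊢ spos A
      focL : ∀ {Γ A U} → hneg A ∈ Γ → Γ ⨾[ A ]⊢ U → Γ ⨾ [] ⊢ stable→isucc U
      η⁺   : ∀ {Γ a Ω U} (q : pol a ≡ positive) →
             (hsusp (patom a q) ∷ Γ) ⨾ Ω ⊢ U → Γ ⨾ (patom a q ∷ Ω) ⊢ U
      ↓L   : ∀ {Γ A Ω U} → (hneg A ∷ Γ) ⨾ Ω ⊢ U → Γ ⨾ (↓ A ∷ Ω) ⊢ U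
      ⊥L   : ∀ {Γ Ω U} → Γ ⨾ (⊥⁺ ∷ Ω) ⊢ U
      ∨L   : ∀ {Γ A B Ω U} → Γ ⨾ (A ∷ Ω) ⊢ U → Γ ⨾ (B ∷ Ω) ⊢ U →
             Γ ⨾ (A ∨⁺ B ∷ Ω) ⊢ U
      ⊤⁺L  : ∀ {Γ Ω U} → Γ ⨾ Ω ⊢ U → Γ ⨾ (⊤⁺ ∷ Ω) ⊢ U
      ∧⁺L  : ∀ {Γ A B Ω U} → Γ ⨾ (A ∷ B ∷ Ω) ⊢ U → Γ ⨾ (A ∧⁺ B ∷ Ω) ⊢ U
      η⁻   : ∀ {Γ a} (q : pol a ≡ negative) →
             Γ ⨾ [] ⊢ ssusp (natom a q) → Γ ⨾ [] ⊢ sneg (natom a q)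
      ↑R   : ∀ {Γ A} → Γ ⨾ [] ⊢ spos A → Γ ⨾ [] ⊢ sneg (↑ A)
      ⊃R   : ∀ {Γ A B} → Γ ⨾ (A ∷ []) ⊢ sneg B → Γ ⨾ [] ⊢ sneg (A ⊃⁻ B)
      ⊤⁻R  : ∀ {Γ} → Γ ⨾ [] ⊢ sneg ⊤⁻
      ∧⁻R  : ∀ {Γ A B} → Γ ⨾ [] ⊢ sneg A → Γ ⨾ [] ⊢ sneg B →
             Γ ⨾ [] ⊢ sneg (A ∧⁻ B)

    infix 4 _⨾[_]⊢_
    data _⨾[_]⊢_ : Ctx → Neg → Stable → Set where
      id⁻  : ∀ {Γ A} → Γ ⨾[ A ]⊢ stsusp A
      ↑L   : ∀ {Γ A U} → Γ ⨾ (A ∷ []) ⊢ stable→isucc U → Γ ⨾[ ↑ A ]⊢ U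
      ⊃L   : ∀ {Γ A B U} → Γ ⊢[ A ] → Γ ⨾[ B ]⊢ U → Γ ⨾[ A ⊃⁻ B ]⊢ U
      ∧⁻L1 : ∀ {Γ A B U} → Γ ⨾[ A ]⊢ U → Γ ⨾[ A ∧⁻ B ]⊢ U
      ∧⁻L2 : ∀ {Γ A B U} → Γ ⨾[ B ]⊢ U → Γ ⨾[ A ∧⁻ B ]⊢ U

  data IsAtomPos : Pos → Set where
    isAtom⁺ : ∀ a q → IsAtomPos (patom a q)

  data IsAtomNeg : Neg → Set where
    isAtom⁻ : ∀ a q → IsAtomNeg (natom a q)

  data SNHyp : Hyp → Set where
    snneg  : ∀ A → SNHyp (hneg A)
    snsusp : ∀ {A} → IsAtomPos A → SNHyp (hsusp A)

  SNCtx : Ctx → Set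
  SNCtx = All SNHyp

  data SNISucc : ISucc → Set where
    snpos  : ∀ A → SNISucc (spos A)
    snneg  : ∀ A → SNISucc (sneg A)
    snsusp : ∀ {A} → IsAtomNeg A → SNISucc (ssusp A)

  data SNStable : Stable → Set where
    snpos  : ∀ A → SNStable (stpos A)
    snsusp : ∀ {A} → IsAtomNeg A → SNStable (stsusp A)

  mutual
    ∣_∣⁺ : Pos → Prop
    ∣ patom a _ ∣⁺ = atom a
    ∣ ↓ A ∣⁺       = ∣ A ∣⁻
    ∣ ⊥⁺ ∣⁺        = ⊥ᵘ
    ∣ A ∨⁺ B ∣⁺    = ∣ A ∣⁺ ∨ᵘ ∣ B ∣⁺
    ∣ ⊤⁺ ∣⁺        = ⊤ᵘ
    ∣ A ∧⁺ B ∣⁺    = ∣ A ∣⁺ ∧ᵘ ∣ B ∣⁺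

    ∣_∣⁻ : Neg → Prop
    ∣ natom a _ ∣⁻ = atom a
    ∣ ↑ A ∣⁻       = ∣ A ∣⁺
    ∣ A ⊃⁻ B ∣⁻    = ∣ A ∣⁺ ⊃ᵘ ∣ B ∣⁻
    ∣ ⊤⁻ ∣⁻        = ⊤ᵘ
    ∣ A ∧⁻ B ∣⁻    = ∣ A ∣⁻ ∧ᵘ ∣ B ∣⁻

  eraseΩ : ICtx → List Prop
  eraseΩ []      = []
  eraseΩ (A ∷ Ω) = ∣ A ∣⁺ ∷ eraseΩ Ω

  eraseΓ : (Γ : Ctx) → SNCtx Γ → UCtx
  eraseΓ []      []                              = []
  eraseΓ (hneg A ∷ Γ) (_ ∷ sn)                   = ∣ A ∣⁻ ∷ eraseΓ Γ sn
  eraseΓ (hsusp _ ∷ Γ) (snsusp (isAtom⁺ a _) ∷ sn) = atom a ∷ eraseΓ Γ sn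

  eraseU : (U : ISucc) → SNISucc U → Prop
  eraseU (spos A)  _                          = ∣ A ∣⁺
  eraseU (sneg A)  _                          = ∣ A ∣⁻
  eraseU (ssusp _) (snsusp (isAtom⁻ a _))     = atom a

  eraseS : (U : Stable) → SNStable U → Prop
  eraseS (stpos A)  _                         = ∣ A ∣⁺
  eraseS (stsusp _) (snsusp (isAtom⁻ a _))    = atom a

-- Every rule of the unfocused calculus only extends the context or inspects
-- membership in it, so derivability is closed under weakening along any
-- inclusion of contexts; since contexts are lists read as multisets, this
-- covers exchange and contraction as well.
-- The main argument is a simultaneous induction on focused derivations with
-- flat conclusions: right focus gives  Γ⊛ ⊢ A•, inversion gives
-- Ω• ++ Γ⊛ ⊢ U⊛, and left focus gives  A•, Γ⊛ ⊢ U⊛.  Each focused rule is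
-- matched by an unfocused or consuming rule; identities are only needed for
-- atoms, because suspensions in suspension-normal contexts and succedents
-- are atomic.  The theorem follows by unfolding the flat conclusions.
module Submission where

open import Defs
open import Data.List using ([]; _∷_; _++_)
open import Data.List.Membership.Propositional using (_∈_)
open import Data.List.Relation.Unary.Any using (here; there)
open import Data.List.Relation.Unary.All using (_∷_)
open import Data.List.Relation.Binary.Subset.Propositional using (_⊆_)
open import Data.List.Relation.Binary.Subset.Propositional.Properties
  using (⊆-refl; ⊆-reflexive-↭; xs⊆x∷xs; ∷⁺ʳ; ∈-∷⁺ʳ)
open import Data.List.Relation.Binary.Permutation.Propositional using (↭-sym)
open import Data.List.Relation.Binary.Permutation.Propositional.Properties using (shift)
open import Data.Product using (_×_; _,_)
open import Relation.Binary.PropositionalEquality using (_≡_; refl; subst)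

module Defocalization (Atom : Set) (pol : Atom → Polarity) where
  open Logic Atom pol

  weaken : ∀ {Γ Δ Q} → Γ ⊆ Δ → Γ ⊢ᵘ Q → Δ ⊢ᵘ Q
  weaken s (init m)   = init (s m)
  weaken s (⊥L m)     = ⊥L (s m)
  weaken s (∨R1 d)    = ∨R1 (weaken s d)
  weaken s (∨R2 d)    = ∨R2 (weaken s d)
  weaken s (∨L m d e) = ∨L (s m) (weaken (∷⁺ʳ _ s) d) (weaken (∷⁺ʳ _ s) e)
  weaken s ⊤R         = ⊤R
  weaken s (∧R d e)   = ∧R (weaken s d) (weaken s e)
  weaken s (∧L1 m d)  = ∧L1 (s m) (weaken (∷⁺ʳ _ s) d)
  weaken s (∧L2 m d)  = ∧L2 (s m) (weaken (∷⁺ʳ _ s) d)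
  weaken s (⊃R d)     = ⊃R (weaken (∷⁺ʳ _ s) d)
  weaken s (⊃L m d e) = ⊃L (s m) (weaken s d) (weaken (∷⁺ʳ _ s) e)

  contract : ∀ {Γ P Q} → P ∈ Γ → (P ∷ Γ) ⊢ᵘ Q → Γ ⊢ᵘ Q
  contract m = weaken (∈-∷⁺ʳ m ⊆-refl)

  exchange-out : ∀ Ψ {Γ P Q} → (Ψ ++ P ∷ Γ) ⊢ᵘ Q → (P ∷ Ψ ++ Γ) ⊢ᵘ Q
  exchange-out Ψ = weaken (⊆-reflexive-↭ (shift _ Ψ _))

  exchange-in : ∀ Ψ {Γ P Q} → (P ∷ Ψ ++ Γ) ⊢ᵘ Q → (Ψ ++ P ∷ Γ) ⊢ᵘ Q
  exchange-in Ψ = weaken (⊆-reflexive-↭ (↭-sym (shift _ Ψ _)))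

  -- Weakening by a hypothesis inserted just below the head of the context.
  -- This is what turns the rules' "principal formula stays" premises into
  -- premises where it has been consumed.
  weaken-below : ∀ {Γ P R Q} → (P ∷ Γ) ⊢ᵘ Q → (P ∷ R ∷ Γ) ⊢ᵘ Q
  weaken-below = weaken (∷⁺ʳ _ (xs⊆x∷xs _ _))

  -- Consuming left rules: the principal formula is the head of the context
  -- and does not recur in the premises.  They are admissible by weakening.
  ∨L-head : ∀ {Γ P₁ P₂ Q} → (P₁ ∷ Γ) ⊢ᵘ Q → (P₂ ∷ Γ) ⊢ᵘ Q → (P₁ ∨ᵘ P₂ ∷ Γ) ⊢ᵘ Q
  ∨L-head d e = ∨L (here refl) (weaken-below d) (weaken-below e)

  ∧L1-head : ∀ {Γ P₁ P₂ Q} → (P₁ ∷ Γ) ⊢ᵘ Q → (P₁ ∧ᵘ P₂ ∷ Γ) ⊢ᵘ Q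
  ∧L1-head d = ∧L1 (here refl) (weaken-below d)

  ∧L2-head : ∀ {Γ P₁ P₂ Q} → (P₂ ∷ Γ) ⊢ᵘ Q → (P₁ ∧ᵘ P₂ ∷ Γ) ⊢ᵘ Q
  ∧L2-head d = ∧L2 (here refl) (weaken-below d)

  ∧L-head : ∀ {Γ P₁ P₂ Q} → (P₁ ∷ P₂ ∷ Γ) ⊢ᵘ Q → (P₁ ∧ᵘ P₂ ∷ Γ) ⊢ᵘ Q
  ∧L-head d = ∧L2 (here refl) (∧L1 (there (here refl)) (weaken (∷⁺ʳ _ (∷⁺ʳ _ (xs⊆x∷xs _ _))) d))

  ⊃L-head : ∀ {Γ P₁ P₂ Q} → Γ ⊢ᵘ P₁ → (P₂ ∷ Γ) ⊢ᵘ Q → (P₁ ⊃ᵘ P₂ ∷ Γ) ⊢ᵘ Q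
  ⊃L-head d e = ⊃L (here refl) (weaken (xs⊆x∷xs _ _) d) (weaken-below e)

  ⊤L-head : ∀ {Γ Q} → Γ ⊢ᵘ Q → (⊤ᵘ ∷ Γ) ⊢ᵘ Q
  ⊤L-head = weaken (xs⊆x∷xs _ _)

  unfold : ∀ Ψ {Γ Q} → (Ψ ++ Γ) ⊢ᵘ Q → Γ ⨾ Ψ ⊢ᵘ Q
  unfold []      d = nil d
  unfold (P ∷ Ψ) d = cons (unfold Ψ (exchange-in Ψ d))

  neg∈ : ∀ {Γ A} (snΓ : SNCtx Γ) → hneg A ∈ Γ → ∣ A ∣⁻ ∈ eraseΓ Γ snΓ
  neg∈ (_ ∷ _)                          (here refl) = here refl
  neg∈ {hneg _ ∷ _}  (_ ∷ snΓ)          (there m)   = there (neg∈ snΓ m)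
  neg∈ {hsusp _ ∷ _} (snsusp (isAtom⁺ _ _) ∷ snΓ) (there m) = there (neg∈ snΓ m)

  -- A suspended hypothesis of a suspension-normal context is an atom, so its
  -- erasure is derivable by the unfocused init rule.
  susp-init : ∀ {Γ A} (snΓ : SNCtx Γ) → hsusp A ∈ Γ → eraseΓ Γ snΓ ⊢ᵘ ∣ A ∣⁺
  susp-init (snsusp (isAtom⁺ _ _) ∷ _)  (here refl) = init (here refl)
  susp-init {hneg _ ∷ _}  (_ ∷ snΓ)     (there m)   = weaken (xs⊆x∷xs _ _) (susp-init snΓ m)
  susp-init {hsusp _ ∷ _} (snsusp (isAtom⁺ _ _) ∷ snΓ) (there m) =
    weaken (xs⊆x∷xs _ _) (susp-init snΓ m)

  sn-stable : (U : Stable) → SNStable U → SNISucc (stable→isucc U)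
  sn-stable (stpos A)  _          = snpos A
  sn-stable (stsusp _) (snsusp i) = snsusp i

  erase-stable : (U : Stable) (snU : SNStable U) →
                 eraseU (stable→isucc U) (sn-stable U snU) ≡ eraseS U snU
  erase-stable (stpos _)  (snpos _)                = refl
  erase-stable (stsusp _) (snsusp (isAtom⁻ _ _)) = refl

  -- Left focus is stated for stable succedents viewed as inversion
  -- succedents, so that it composes with focL and ↑L without conversion.
  mutual
    defocus-right : ∀ {Γ A} (snΓ : SNCtx Γ) → Γ ⊢[ A ] → eraseΓ Γ snΓ ⊢ᵘ ∣ A ∣⁺
    defocus-right snΓ (id⁺ m)   = susp-init snΓ m
    defocus-right snΓ (↓R d)    = defocus-inv snΓ (snneg _) d
    defocus-right snΓ (∨R1 d)   = ∨R1 (defocus-right snΓ d)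
    defocus-right snΓ (∨R2 d)   = ∨R2 (defocus-right snΓ d)
    defocus-right snΓ ⊤⁺R       = ⊤R
    defocus-right snΓ (∧⁺R d e) = ∧R (defocus-right snΓ d) (defocus-right snΓ e)

    defocus-inv : ∀ {Γ Ω U} (snΓ : SNCtx Γ) (snU : SNISucc U) →
                  Γ ⨾ Ω ⊢ U → (eraseΩ Ω ++ eraseΓ Γ snΓ) ⊢ᵘ eraseU U snU
    defocus-inv snΓ snU (focR d)     = defocus-right snΓ d
    defocus-inv snΓ snU (focL m d)   = contract (neg∈ snΓ m) (defocus-left snΓ snU d)
    defocus-inv snΓ snU (η⁺ {a = a} {Ω = Ω} q d) =
      exchange-out (eraseΩ Ω) (defocus-inv (snsusp (isAtom⁺ a q) ∷ snΓ) snU d)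
    defocus-inv snΓ snU (↓L {A = A} {Ω = Ω} d) =
      exchange-out (eraseΩ Ω) (defocus-inv (snneg A ∷ snΓ) snU d)
    defocus-inv snΓ snU ⊥L        = ⊥L (here refl)
    defocus-inv snΓ snU (∨L d e)  = ∨L-head (defocus-inv snΓ snU d) (defocus-inv snΓ snU e)
    defocus-inv snΓ snU (⊤⁺L d)   = ⊤L-head (defocus-inv snΓ snU d)
    defocus-inv snΓ snU (∧⁺L d)   = ∧L-head (defocus-inv snΓ snU d)
    defocus-inv snΓ snU (η⁻ {a = a} q d) = defocus-inv snΓ (snsusp (isAtom⁻ a q)) d
    defocus-inv snΓ snU (↑R d)    = defocus-inv snΓ (snpos _) d
    defocus-inv snΓ snU (⊃R d)    = ⊃R (defocus-inv snΓ (snneg _) d)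
    defocus-inv snΓ snU ⊤⁻R       = ⊤R
    defocus-inv snΓ snU (∧⁻R d e) = ∧R (defocus-inv snΓ (snneg _) d) (defocus-inv snΓ (snneg _) e)

    defocus-left : ∀ {Γ A U} (snΓ : SNCtx Γ) (snU : SNISucc (stable→isucc U)) →
                   Γ ⨾[ A ]⊢ U → (∣ A ∣⁻ ∷ eraseΓ Γ snΓ) ⊢ᵘ eraseU (stable→isucc U) snU
    defocus-left snΓ (snsusp (isAtom⁻ _ _)) id⁻ = init (here refl)
    defocus-left snΓ snU (↑L d)    = defocus-inv snΓ snU d
    defocus-left snΓ snU (⊃L d e)  = ⊃L-head (defocus-right snΓ d) (defocus-left snΓ snU e)
    defocus-left snΓ snU (∧⁻L1 d)  = ∧L1-head (defocus-left snΓ snU d)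
    defocus-left snΓ snU (∧⁻L2 d)  = ∧L2-head (defocus-left snΓ snU d)

theorem1 : (Atom : Set) (pol : Atom → Polarity) →
    let open Logic Atom pol in
      (∀ {Γ A} (snΓ : SNCtx Γ) →
         Γ ⊢[ A ] → eraseΓ Γ snΓ ⨾ [] ⊢ᵘ ∣ A ∣⁺)
    × (∀ {Γ Ω U} (snΓ : SNCtx Γ) (snU : SNISucc U) →
         Γ ⨾ Ω ⊢ U → eraseΓ Γ snΓ ⨾ eraseΩ Ω ⊢ᵘ eraseU U snU)
    × (∀ {Γ A U} (snΓ : SNCtx Γ) (snU : SNStable U) →
         Γ ⨾[ A ]⊢ U → eraseΓ Γ snΓ ⨾ (∣ A ∣⁻ ∷ []) ⊢ᵘ eraseS U snU)
theorem1 Atom pol =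
    (λ snΓ d → nil (defocus-right snΓ d))
  , (λ {_} {Ω} snΓ snU d → unfold (eraseΩ Ω) (defocus-inv snΓ snU d))
  , (λ {_} {_} {U} snΓ snU d →
       unfold (_ ∷ []) (subst (_ ⊢ᵘ_) (erase-stable U snU)
                              (defocus-left snΓ (sn-stable U snU) d)))
  where
    open Logic Atom pol
    open Defocalization Atom pol
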